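{- Given any collection of pairwise compatible arcs on $n$ points, there is a noncrossing arc diagram whose arcs are combinatorially equivalent to the given arcs.
   Context: Place points $1,\ldots,n$ bottom to top on a vertical line. An arc joins a point $p$ to a strictly higher point $q$, moving monotonically upward and passing left or right of each point strictly between $p$ and $q$. Two arcs are combinatorially equivalent if they have the same endpoints and the same set of intermediate points to their left. A noncrossing arc diagram is a collection of arcs drawn so that no two intersect except possibly at endpoints and no two share the same upper endpoint or the same lower endpoint. Two arcs are compatible if there exists a noncrossing arc diagram containing (arcs combinatorially equivalent to) both of them. -}

module Defs where

open import Data.Nat using (ℕ; zero; suc; _≤_; _<_)
open import Data.Bool using (Bool; true; false)
open import Data.List using (List; length; lookup)
open import Data.List.Relation.Unary.Any using (Any)
open import Data.List.Relation.Unary.All using (All)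
open import Data.Fin using (Fin)
open import Data.Product using (Σ; ∃; _×_; _,_)
open import Relation.Binary.PropositionalEquality using (_≡_; _≢_)

-- Points are 0, 1, ..., n-1, bottom to top (points 1..n of the paper, shifted by one).
-- An arc (up to combinatorial equivalence) is given by its lower endpoint, its upper
-- endpoint and, for every point, whether the arc passes to the LEFT of it
-- (only the values at intermediate points bot < x < top are meaningful).
record Arc (n : ℕ) : Set where
  constructor arc
  field
    bot     : ℕ
    top     : ℕ
    bot<top : bot < top
    top<n   : top < n
    leftOf  : ℕ → Bool

open Arc public

Intermediate : {n : ℕ} → Arc n → ℕ → Set
Intermediate a x = bot a < x × x < top a

_≈ᵃ_ : {n : ℕ} → Arc n → Arc n → Set
a ≈ᵃ b = bot a ≡ bot b × top a ≡ top b
       × (∀ x → Intermediate a x → leftOf a x ≡ leftOf b x)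

-- the arc a crosses the horizontal gap between heights g and g+1
Spans : {n : ℕ} → Arc n → ℕ → Set
Spans a g = bot a ≤ g × g < top a

-- A noncrossing arc diagram, recorded combinatorially: the (combinatorial types of the)
-- drawn arcs, together with the left-to-right positions `pos i g` of the arcs at the
-- horizontal line in the gap g (between points g and g+1). The conditions say exactly
-- that the monotone curves can be drawn with no two meeting except at common endpoints:
-- distinct positions within each gap, relative order of two arcs preserved when both
-- pass a point, the arcs passing left of a point x being left of the arcs passing right
-- of x, and arcs ending/starting at x being placed on the correct side of arcs
-- passing through x.
record NoncrossingArcDiagram (n : ℕ) : Set where
  field
    arcs : List (Arc n)
    pos  : Fin (length arcs) → ℕ → ℕ
    distinct-bot : ∀ i j → i ≢ j → bot (lookup arcs i) ≢ bot (lookup arcs j)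
    distinct-top : ∀ i j → i ≢ j → top (lookup arcs i) ≢ top (lookup arcs j)
    separated : ∀ i j g → i ≢ j → Spans (lookup arcs i) g → Spans (lookup arcs j) g
              → pos i g ≢ pos j g
    order-kept : ∀ i j g → Intermediate (lookup arcs i) (suc g) → Intermediate (lookup arcs j) (suc g)
              → pos i g < pos j g → pos i (suc g) < pos j (suc g)
    sides : ∀ i j x → Intermediate (lookup arcs i) x → Intermediate (lookup arcs j) x
              → leftOf (lookup arcs i) x ≡ true → leftOf (lookup arcs j) x ≡ false
              → pos i x < pos j x
    ending : ∀ e t g → top (lookup arcs e) ≡ suc g → Intermediate (lookup arcs t) (suc g)
              → (leftOf (lookup arcs t) (suc g) ≡ true → pos t g < pos e g)
              × (leftOf (lookup arcs t) (suc g) ≡ false → pos e g < pos t g)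
    starting : ∀ s t x → bot (lookup arcs s) ≡ x → Intermediate (lookup arcs t) x
              → (leftOf (lookup arcs t) x ≡ true → pos t x < pos s x)
              × (leftOf (lookup arcs t) x ≡ false → pos s x < pos t x)

open NoncrossingArcDiagram public

_∈ᴰ_ : {n : ℕ} → Arc n → NoncrossingArcDiagram n → Set
a ∈ᴰ D = Any (a ≈ᵃ_) (arcs D)

Compatible : {n : ℕ} → Arc n → Arc n → Set
Compatible {n} a b = Σ (NoncrossingArcDiagram n) λ D → a ∈ᴰ D × b ∈ᴰ D

{-# OPTIONS --safe #-}

-- In a noncrossing diagram the left-to-right order of two arcs crossing the gap above a
-- point g is forced by their combinatorial types: scanning down from g to the first point y
-- where they behave differently, either they pass y on different sides, or one of them
-- starts at y while the other passes it (two arcs cannot both start at y), and in each case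
-- the axioms decide which arc is on the left. Writing code a y = 0, 1, 2 according as the
-- arc a passes left of y (or does not reach y), starts at y, or passes right of y, the
-- forced order is the order of the base-3 numbers key a g = Σ_{y ≤ g} code a y · 3^y.
-- Every axiom of a diagram involves at most two arcs, so for a pairwise compatible family
-- the positions key satisfy it because the pair lies in some diagram. Keeping one arc per
-- lower endpoint removes repetitions, since compatible arcs with the same lower (or upper)
-- endpoint are equivalent.

module Submission where

open import Defs
open import Data.Nat using (ℕ; zero; suc; _+_; _*_; _^_; _≤_; _<_; z≤n; s≤s; _≟_; _<?_)
open import Data.Nat.Properties
open import Data.Bool using (Bool; true; false)
open import Data.Fin using (Fin) renaming (zero to fzero; suc to fsuc; _≟_ to _≟ᶠ_)
open import Data.List using (List; length; lookup; deduplicate)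
open import Data.List.Relation.Unary.Any as Any using (Any; index)
open import Data.List.Relation.Unary.Any.Properties using (lookup-index; deduplicate⁺)
open import Data.List.Relation.Unary.All as All using (All)
open import Data.List.Relation.Unary.AllPairs using (_∷_)
open import Data.List.Relation.Unary.Unique.Setoid using (Unique)
open import Data.List.Relation.Unary.Unique.DecSetoid.Properties using (deduplicate-!)
open import Data.List.Membership.Propositional using (_∈_; find; lose)
open import Data.List.Membership.Propositional.Properties using (∈-lookup; ∈-deduplicate⁻)
open import Data.Product using (Σ; _×_; _,_; proj₁; proj₂; uncurry)
open import Data.Sum using (_⊎_; inj₁; inj₂)
open import Function using (_∘_)
open import Level using (0ℓ)
open import Relation.Binary.Bundles using (Setoid; DecSetoid)
open import Relation.Binary.Definitions using (tri<; tri≈; tri>)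
import Relation.Binary.Construct.On as On
open import Relation.Nullary using (Dec; yes; no; contradiction)
open import Relation.Nullary.Decidable using (decidable-stable)
open import Relation.Binary.PropositionalEquality

m*o+r<n*o : ∀ {m n o r} → m < n → r < o → m * o + r < n * o
m*o+r<n*o {m} {n} {o} {r} m<n r<o = begin-strict
  m * o + r   <⟨ +-monoʳ-< (m * o) r<o ⟩
  m * o + o   ≡⟨ +-comm (m * o) o ⟩
  suc m * o   ≤⟨ *-monoˡ-≤ o m<n ⟩
  n * o       ∎
  where open ≤-Reasoning

module _ (b : ℕ) where

  numeral : (ℕ → ℕ) → ℕ → ℕ
  numeral d zero    = d zero
  numeral d (suc g) = d (suc g) * b ^ suc g + numeral d g

  numeral-< : ∀ {d} → (∀ y → d y < b) → ∀ g → numeral d g < b ^ suc g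
  numeral-< d<b zero    = subst (_ <_) (sym (*-identityʳ b)) (d<b zero)
  numeral-< d<b (suc g) = m*o+r<n*o (d<b (suc g)) (numeral-< d<b g)

  numeral-<-leading : ∀ {d e} → (∀ y → d y < b) → ∀ g → d g < e g → numeral d g < numeral e g
  numeral-<-leading d<b zero    lt = lt
  numeral-<-leading {d} {e} d<b (suc g) lt = begin-strict
    d (suc g) * b ^ suc g + numeral d g   <⟨ m*o+r<n*o lt (numeral-< d<b g) ⟩
    e (suc g) * b ^ suc g                 ≤⟨ m≤m+n _ _ ⟩
    numeral e (suc g)                     ∎
    where open ≤-Reasoning

  numeral-<-inv : ∀ {d e} → (∀ y → d y < b) → (∀ y → e y < b) → ∀ g
                → numeral d (suc g) < numeral e (suc g)
                → d (suc g) < e (suc g) ⊎ (d (suc g) ≡ e (suc g) × numeral d g < numeral e g)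
  numeral-<-inv {d} {e} d<b e<b g lt with <-cmp (d (suc g)) (e (suc g))
  ... | tri< lead< _ _ = inj₁ lead<
  ... | tri≈ _ lead≡ _ = inj₂ (lead≡ , +-cancelˡ-< (e (suc g) * b ^ suc g) _ _
                                          (subst (λ x → x * b ^ suc g + numeral d g < _) lead≡ lt))
  ... | tri> _ _ lead> = contradiction lt (<⇒≯ (numeral-<-leading e<b (suc g) lead>))

  numeral-≡⇒leading-≡ : ∀ {d e} → (∀ y → d y < b) → (∀ y → e y < b) → ∀ g
                      → numeral d g ≡ numeral e g → d g ≡ e g
  numeral-≡⇒leading-≡ {d} {e} d<b e<b g eq with <-cmp (d g) (e g)
  ... | tri< lead< _ _ = contradiction eq (<⇒≢ (numeral-<-leading d<b g lead<))
  ... | tri≈ _ lead≡ _ = lead≡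
  ... | tri> _ _ lead> = contradiction (sym eq) (<⇒≢ (numeral-<-leading e<b g lead>))

  numeral-≡⇒tail-≡ : ∀ {d e} → (∀ y → d y < b) → (∀ y → e y < b) → ∀ g
                    → numeral d (suc g) ≡ numeral e (suc g) → numeral d g ≡ numeral e g
  numeral-≡⇒tail-≡ {d} {e} d<b e<b g eq = +-cancelˡ-≡ (e (suc g) * b ^ suc g) _ _
    (subst (λ x → x * b ^ suc g + numeral d g ≡ _) (numeral-≡⇒leading-≡ d<b e<b (suc g) eq) eq)

  numeral-cong : ∀ {d e} → (∀ y → d y ≡ e y) → ∀ g → numeral d g ≡ numeral e g
  numeral-cong d≡e zero    = d≡e zero
  numeral-cong d≡e (suc g) = cong₂ (λ x r → x * b ^ suc g + r) (d≡e (suc g)) (numeral-cong d≡e g)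

  numeral-zeros : ∀ {d} g → (∀ y → y ≤ g → d y ≡ 0) → numeral d g ≡ 0
  numeral-zeros zero    zeros = zeros zero z≤n
  numeral-zeros (suc g) zeros rewrite zeros (suc g) ≤-refl =
    numeral-zeros g (λ y y≤g → zeros y (m≤n⇒m≤1+n y≤g))

side : Bool → ℕ
side true  = 0
side false = 2

side<1⇒true : ∀ {l} → side l < 1 → l ≡ true
side<1⇒true {true}  _ = refl
side<1⇒true {false} (s≤s ())

1<side⇒false : ∀ {l} → 1 < side l → l ≡ false
1<side⇒false {false} _ = refl
1<side⇒false {true}  ()

side≢1 : ∀ l → side l ≢ 1
side≢1 true  ()
side≢1 false ()

side-<⇒true-false : ∀ {l r} → side l < side r → l ≡ true × r ≡ false
side-<⇒true-false {true}  {false} _ = refl , refl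
side-<⇒true-false {true}  {true}  ()
side-<⇒true-false {false} {false} (s≤s (s≤s ()))

module _ {n : ℕ} where

  ≈ᵃ-refl : (a : Arc n) → a ≈ᵃ a
  ≈ᵃ-refl a = refl , refl , λ _ _ → refl

  ≈ᵃ-intermediate : (a b : Arc n) → a ≈ᵃ b → ∀ {x} → Intermediate a x → Intermediate b x
  ≈ᵃ-intermediate a b (bot≡ , top≡ , _) {x} (p , q) = subst (_< x) bot≡ p , subst (x <_) top≡ q

  ≈ᵃ-sym : (a b : Arc n) → a ≈ᵃ b → b ≈ᵃ a
  ≈ᵃ-sym a b (bot≡ , top≡ , left≡) = sym bot≡ , sym top≡ ,
    λ x (p , q) → sym (left≡ x (subst (_< x) (sym bot≡) p , subst (x <_) (sym top≡) q))

  ≈ᵃ-trans : (a b c : Arc n) → a ≈ᵃ b → b ≈ᵃ c → a ≈ᵃ c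
  ≈ᵃ-trans a b c a≈b@(bot≡ , top≡ , left≡) (bot≡′ , top≡′ , left≡′) =
    trans bot≡ bot≡′ , trans top≡ top≡′ ,
    λ x ia → trans (left≡ x ia) (left≡′ x (≈ᵃ-intermediate a b a≈b ia))

  Intermediate⇒Spans : (a : Arc n) → ∀ {x} → Intermediate a x → Spans a x
  Intermediate⇒Spans a (p , q) = <⇒≤ p , q

  Intermediate-suc⇒Spans : (a : Arc n) → ∀ {g} → Intermediate a (suc g) → Spans a g
  Intermediate-suc⇒Spans a (p , q) = m<1+n⇒m≤n p , <-trans (n<1+n _) q

  top-≡-suc⇒Spans : (a : Arc n) → ∀ {g} → top a ≡ suc g → Spans a g
  top-≡-suc⇒Spans a top≡ = m<1+n⇒m≤n (subst (bot a <_) top≡ (bot<top a)) , ≤-reflexive (sym top≡)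

  Spans⇒start⊎Intermediate : (a : Arc n) → ∀ {g} → Spans a g → g ≡ bot a ⊎ Intermediate a g
  Spans⇒start⊎Intermediate a {g} (bot≤g , g<top) with <-cmp (bot a) g
  ... | tri< bot<g _ _ = inj₂ (bot<g , g<top)
  ... | tri≈ _ bot≡g _ = inj₁ (sym bot≡g)
  ... | tri> _ _ bot>g = contradiction bot≤g (<⇒≱ bot>g)

  code : Arc n → ℕ → ℕ
  code a y with <-cmp (bot a) y
  ... | tri> _ _ _ = 0
  ... | tri≈ _ _ _ = 1
  ... | tri< _ _ _ with y <? top a
  ...   | yes _ = side (leftOf a y)
  ...   | no  _ = 0

  code<3 : (a : Arc n) → ∀ y → code a y < 3
  code<3 a y with <-cmp (bot a) y
  ... | tri> _ _ _ = s≤s z≤n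
  ... | tri≈ _ _ _ = s≤s (s≤s z≤n)
  ... | tri< _ _ _ with y <? top a
  ...   | no  _ = s≤s z≤n
  ...   | yes _ with leftOf a y
  ...     | true  = s≤s z≤n
  ...     | false = ≤-refl

  code-bot : (a : Arc n) → ∀ {y} → y ≡ bot a → code a y ≡ 1
  code-bot a refl with <-cmp (bot a) (bot a)
  ... | tri< bot<bot _ _ = contradiction bot<bot (<-irrefl refl)
  ... | tri≈ _ _ _ = refl
  ... | tri> _ _ bot>bot = contradiction bot>bot (<-irrefl refl)

  code-below : (a : Arc n) → ∀ {y} → y < bot a → code a y ≡ 0
  code-below a {y} y<bot with <-cmp (bot a) y
  ... | tri< bot<y _ _ = contradiction y<bot (<⇒≯ bot<y)
  ... | tri≈ _ bot≡y _ = contradiction (sym bot≡y) (<⇒≢ y<bot)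
  ... | tri> _ _ _ = refl

  code-above : (a : Arc n) → ∀ {y} → top a ≤ y → code a y ≡ 0
  code-above a {y} top≤y with <-cmp (bot a) y
  ... | tri≈ _ bot≡y _ = contradiction (subst (top a ≤_) (sym bot≡y) top≤y) (<⇒≱ (bot<top a))
  ... | tri> _ _ _ = refl
  ... | tri< _ _ _ with y <? top a
  ...   | yes y<top = contradiction top≤y (<⇒≱ y<top)
  ...   | no  _ = refl

  code-intermediate : (a : Arc n) → ∀ {y l} → Intermediate a y → leftOf a y ≡ l → code a y ≡ side l
  code-intermediate a {y} (bot<y , y<top) refl with <-cmp (bot a) y
  ... | tri≈ _ bot≡y _ = contradiction bot≡y (<⇒≢ bot<y)
  ... | tri> _ _ bot>y = contradiction bot<y (<⇒≯ bot>y)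
  ... | tri< _ _ _ with y <? top a
  ...   | yes _ = refl
  ...   | no y≮top = contradiction y<top y≮top

  code-intermediate≢1 : (a : Arc n) → ∀ {y} → Intermediate a y → code a y ≢ 1
  code-intermediate≢1 a {y} ia = side≢1 (leftOf a y) ∘ trans (sym (code-intermediate a ia refl))

  code-resp-≈ᵃ : (a b : Arc n) → a ≈ᵃ b → ∀ y → code a y ≡ code b y
  code-resp-≈ᵃ a b a≈b@(bot≡ , top≡ , left≡) y with <-cmp y (bot a)
  ... | tri< y<bot _ _ = trans (code-below a y<bot) (sym (code-below b (subst (y <_) bot≡ y<bot)))
  ... | tri≈ _ y≡bot _ = trans (code-bot a y≡bot) (sym (code-bot b (trans y≡bot bot≡)))
  ... | tri> _ _ bot<y with y <? top a
  ...   | yes y<top = begin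
    code a y               ≡⟨ code-intermediate a (bot<y , y<top) refl ⟩
    side (leftOf a y)      ≡⟨ cong side (left≡ y (bot<y , y<top)) ⟩
    side (leftOf b y)      ≡⟨ code-intermediate b (≈ᵃ-intermediate a b a≈b (bot<y , y<top)) refl ⟨
    code b y               ∎
    where open ≡-Reasoning
  ...   | no y≮top =
    trans (code-above a (≮⇒≥ y≮top)) (sym (code-above b (subst (_≤ y) top≡ (≮⇒≥ y≮top))))

  codes-≡⇒starts⊎Intermediates : (a b : Arc n) → ∀ {g} → Spans a g → Spans b g → code a g ≡ code b g
                                → (g ≡ bot a × g ≡ bot b) ⊎ (Intermediate a g × Intermediate b g)
  codes-≡⇒starts⊎Intermediates a b sa sb code≡
    with Spans⇒start⊎Intermediate a sa | Spans⇒start⊎Intermediate b sb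
  ... | inj₁ sa | inj₁ sb = inj₁ (sa , sb)
  ... | inj₂ ia | inj₂ ib = inj₂ (ia , ib)
  ... | inj₁ sa | inj₂ ib = contradiction (trans (sym code≡) (code-bot a sa)) (code-intermediate≢1 b ib)
  ... | inj₂ ia | inj₁ sb = contradiction (trans code≡ (code-bot b sb)) (code-intermediate≢1 a ia)

  key : Arc n → ℕ → ℕ
  key a = numeral 3 (code a)

  code-<⇒key-< : (a b : Arc n) → ∀ {g} → code a g < code b g → key a g < key b g
  code-<⇒key-< a b {g} = numeral-<-leading 3 (code<3 a) g

  key-resp-≈ᵃ : (a b : Arc n) → a ≈ᵃ b → ∀ g → key a g ≡ key b g
  key-resp-≈ᵃ a b a≈b = numeral-cong 3 (code-resp-≈ᵃ a b a≈b)

  key-below-bot : (a : Arc n) → ∀ {g} → g < bot a → key a g ≡ 0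
  key-below-bot a {g} g<bot = numeral-zeros 3 g (λ y y≤g → code-below a (≤-<-trans y≤g g<bot))

  key-≡⇒bot-≡ : (a b : Arc n) → ∀ g → Spans a g → Spans b g → key a g ≡ key b g → bot a ≡ bot b
  key-≡⇒bot-≡ a b g sa sb key≡
    with codes-≡⇒starts⊎Intermediates a b sa sb (numeral-≡⇒leading-≡ 3 (code<3 a) (code<3 b) g key≡)
  ... | inj₁ (g≡bot-a , g≡bot-b) = trans (sym g≡bot-a) g≡bot-b
  key-≡⇒bot-≡ a b zero    sa sb key≡ | inj₂ ((() , _) , _)
  key-≡⇒bot-≡ a b (suc h) sa sb key≡ | inj₂ (ia , ib) =
    key-≡⇒bot-≡ a b h (Intermediate-suc⇒Spans a ia) (Intermediate-suc⇒Spans b ib)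
      (numeral-≡⇒tail-≡ 3 (code<3 a) (code<3 b) h key≡)

module _ {n : ℕ} (D : NoncrossingArcDiagram n) where

  arcAt : Fin (length (arcs D)) → Arc n
  arcAt = lookup (arcs D)

  bot-≡⇒≡ : ∀ i j → bot (arcAt i) ≡ bot (arcAt j) → i ≡ j
  bot-≡⇒≡ i j bot≡ = decidable-stable (i ≟ᶠ j) λ i≢j → distinct-bot D i j i≢j bot≡

  top-≡⇒≡ : ∀ i j → top (arcAt i) ≡ top (arcAt j) → i ≡ j
  top-≡⇒≡ i j top≡ = decidable-stable (i ≟ᶠ j) λ i≢j → distinct-top D i j i≢j top≡

  code-<⇒pos-< : ∀ i j g → Spans (arcAt i) g → Spans (arcAt j) g
               → code (arcAt i) g < code (arcAt j) g → pos D i g < pos D j g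
  code-<⇒pos-< i j g si sj code<
    with Spans⇒start⊎Intermediate (arcAt i) si | Spans⇒start⊎Intermediate (arcAt j) sj
  ... | inj₁ si | inj₁ sj =
    contradiction code< (<-irrefl (trans (code-bot (arcAt i) si) (sym (code-bot (arcAt j) sj))))
  ... | inj₁ si | inj₂ ij = proj₂ (starting D i j g (sym si) ij)
    (1<side⇒false (subst₂ _<_ (code-bot (arcAt i) si) (code-intermediate (arcAt j) ij refl) code<))
  ... | inj₂ ii | inj₁ sj = proj₁ (starting D j i g (sym sj) ii)
    (side<1⇒true (subst₂ _<_ (code-intermediate (arcAt i) ii refl) (code-bot (arcAt j) sj) code<))
  ... | inj₂ ii | inj₂ ij = uncurry (sides D i j g ii ij) (side-<⇒true-false
    (subst₂ _<_ (code-intermediate (arcAt i) ii refl) (code-intermediate (arcAt j) ij refl) code<))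

  key-<⇒pos-< : ∀ i j g → Spans (arcAt i) g → Spans (arcAt j) g
              → key (arcAt i) g < key (arcAt j) g → pos D i g < pos D j g
  key-<⇒pos-< i j zero    si sj key< = code-<⇒pos-< i j zero si sj key<
  key-<⇒pos-< i j (suc h) si sj key< with numeral-<-inv 3 (code<3 (arcAt i)) (code<3 (arcAt j)) h key<
  ... | inj₁ code< = code-<⇒pos-< i j (suc h) si sj code<
  ... | inj₂ (code≡ , tail<) with codes-≡⇒starts⊎Intermediates (arcAt i) (arcAt j) si sj code≡
  ...   | inj₁ (si , sj) = contradiction tail< (<-irrefl (trans
            (key-below-bot (arcAt i) (≤-reflexive si)) (sym (key-below-bot (arcAt j) (≤-reflexive sj)))))
  ...   | inj₂ (ii , ij) = order-kept D i j h ii ij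
            (key-<⇒pos-< i j h (Intermediate-suc⇒Spans (arcAt i) ii) (Intermediate-suc⇒Spans (arcAt j) ij)
                         tail<)

  pos-<⇒key-< : ∀ i j g → Spans (arcAt i) g → Spans (arcAt j) g
              → pos D i g < pos D j g → key (arcAt i) g < key (arcAt j) g
  pos-<⇒key-< i j g si sj pos< with <-cmp (key (arcAt i) g) (key (arcAt j) g)
  ... | tri< key< _ _ = key<
  ... | tri≈ _ key≡ _ = contradiction pos<
    (<-irrefl (cong (λ k → pos D k g) (bot-≡⇒≡ i j (key-≡⇒bot-≡ (arcAt i) (arcAt j) g si sj key≡))))
  ... | tri> _ _ key> = contradiction (key-<⇒pos-< j i g sj si key>) (<⇒≯ pos<)

module _ {n : ℕ} {x y : Arc n} (c : Compatible x y) where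

  private
    D : NoncrossingArcDiagram n
    D = proj₁ c

    i j : Fin (length (arcs D))
    i = index (proj₁ (proj₂ c))
    j = index (proj₂ (proj₂ c))

    x′ y′ : Arc n
    x′ = arcAt D i
    y′ = arcAt D j

    x≈x′ : x ≈ᵃ x′
    x≈x′ = lookup-index (proj₁ (proj₂ c))

    y≈y′ : y ≈ᵃ y′
    y≈y′ = lookup-index (proj₂ (proj₂ c))

    ≡⇒≈ᵃ : i ≡ j → x ≈ᵃ y
    ≡⇒≈ᵃ i≡j =
      ≈ᵃ-trans x x′ y x≈x′ (≈ᵃ-sym y x′ (subst (λ k → y ≈ᵃ arcAt D k) (sym i≡j) y≈y′))

    keyˣ : ∀ g → key x g ≡ key x′ g
    keyˣ = key-resp-≈ᵃ x x′ x≈x′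

    keyʸ : ∀ g → key y g ≡ key y′ g
    keyʸ = key-resp-≈ᵃ y y′ y≈y′

  compatible-bot-≡⇒≈ᵃ : bot x ≡ bot y → x ≈ᵃ y
  compatible-bot-≡⇒≈ᵃ bot≡ =
    ≡⇒≈ᵃ (bot-≡⇒≡ D i j (trans (sym (proj₁ x≈x′)) (trans bot≡ (proj₁ y≈y′))))

  compatible-top-≡⇒≈ᵃ : top x ≡ top y → x ≈ᵃ y
  compatible-top-≡⇒≈ᵃ top≡ =
    ≡⇒≈ᵃ (top-≡⇒≡ D i j
      (trans (sym (proj₁ (proj₂ x≈x′))) (trans top≡ (proj₁ (proj₂ y≈y′)))))

  compatible-key-<-kept : ∀ g → Intermediate x (suc g) → Intermediate y (suc g)
                        → key x g < key y g → key x (suc g) < key y (suc g)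
  compatible-key-<-kept g ix iy key< =
    subst₂ _<_ (sym (keyˣ (suc g))) (sym (keyʸ (suc g)))
      (pos-<⇒key-< D i j (suc g) (Intermediate⇒Spans x′ ix′) (Intermediate⇒Spans y′ iy′)
        (order-kept D i j g ix′ iy′
          (key-<⇒pos-< D i j g (Intermediate-suc⇒Spans x′ ix′) (Intermediate-suc⇒Spans y′ iy′)
            (subst₂ _<_ (keyˣ g) (keyʸ g) key<))))
    where
    ix′ : Intermediate x′ (suc g)
    ix′ = ≈ᵃ-intermediate x x′ x≈x′ ix
    iy′ : Intermediate y′ (suc g)
    iy′ = ≈ᵃ-intermediate y y′ y≈y′ iy

  compatible-ending : ∀ g → top x ≡ suc g → Intermediate y (suc g)
                    → (leftOf y (suc g) ≡ true → key y g < key x g)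
                    × (leftOf y (suc g) ≡ false → key x g < key y g)
  compatible-ending g top≡ iy =
      (λ left → subst₂ _<_ (sym (keyʸ g)) (sym (keyˣ g))
                  (pos-<⇒key-< D j i g sy′ sx′ (proj₁ end (leftOf′ left))))
    , (λ right → subst₂ _<_ (sym (keyˣ g)) (sym (keyʸ g))
                  (pos-<⇒key-< D i j g sx′ sy′ (proj₂ end (leftOf′ right))))
    where
    top≡′ : top x′ ≡ suc g
    top≡′ = trans (sym (proj₁ (proj₂ x≈x′))) top≡
    iy′ : Intermediate y′ (suc g)
    iy′ = ≈ᵃ-intermediate y y′ y≈y′ iy
    end : (leftOf y′ (suc g) ≡ true → pos D j g < pos D i g)
        × (leftOf y′ (suc g) ≡ false → pos D i g < pos D j g)
    end = ending D i j g top≡′ iy′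
    sx′ : Spans x′ g
    sx′ = top-≡-suc⇒Spans x′ top≡′
    sy′ : Spans y′ g
    sy′ = Intermediate-suc⇒Spans y′ iy′
    leftOf′ : ∀ {l} → leftOf y (suc g) ≡ l → leftOf y′ (suc g) ≡ l
    leftOf′ refl = sym (proj₂ (proj₂ y≈y′) (suc g) iy)

module _ {n : ℕ} (L : List (Arc n))
         (compatible : ∀ i j → i ≢ j → Compatible (lookup L i) (lookup L j))
         (distinct-bots : ∀ i j → i ≢ j → bot (lookup L i) ≢ bot (lookup L j)) where

  canonicalDiagram : NoncrossingArcDiagram n
  canonicalDiagram = record
    { arcs         = L
    ; pos          = λ i → key (lookup L i)
    ; distinct-bot = distinct-bots
    ; distinct-top = λ i j i≢j → distinct-bots i j i≢j ∘ proj₁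
                       ∘ compatible-top-≡⇒≈ᵃ {x = lookup L i} {lookup L j} (compatible i j i≢j)
    ; separated    = λ i j g i≢j si sj →
        distinct-bots i j i≢j ∘ key-≡⇒bot-≡ (lookup L i) (lookup L j) g si sj
    ; order-kept   = key-<-kept
    ; sides        = λ i j x ii ij left right →
        code-<⇒key-< (lookup L i) (lookup L j)
          (subst₂ _<_ (sym (code-intermediate _ ii left)) (sym (code-intermediate _ ij right)) (s≤s z≤n))
    ; ending       = ending′
    ; starting     = λ s t x bot≡ it →
        (λ left → code-<⇒key-< (lookup L t) (lookup L s)
          (subst₂ _<_ (sym (code-intermediate _ it left)) (sym (code-bot _ (sym bot≡))) (s≤s z≤n)))
      , (λ right → code-<⇒key-< (lookup L s) (lookup L t)
          (subst₂ _<_ (sym (code-bot _ (sym bot≡))) (sym (code-intermediate _ it right)) ≤-refl))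
    }
    where
    key-<-kept : ∀ i j g → Intermediate (lookup L i) (suc g) → Intermediate (lookup L j) (suc g)
               → key (lookup L i) g < key (lookup L j) g → key (lookup L i) (suc g) < key (lookup L j) (suc g)
    key-<-kept i j g ii ij key< with i ≟ᶠ j
    ... | yes refl = contradiction key< (<-irrefl refl)
    ... | no i≢j   = compatible-key-<-kept (compatible i j i≢j) g ii ij key<

    ending′ : ∀ e t g → top (lookup L e) ≡ suc g → Intermediate (lookup L t) (suc g)
            → (leftOf (lookup L t) (suc g) ≡ true → key (lookup L t) g < key (lookup L e) g)
            × (leftOf (lookup L t) (suc g) ≡ false → key (lookup L e) g < key (lookup L t) g)
    ending′ e t g top≡ it with e ≟ᶠ t
    ... | yes refl = contradiction (proj₂ it) (<-irrefl (sym top≡))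
    ... | no e≢t   = compatible-ending (compatible e t e≢t) g top≡ it

module _ {a ℓ} (S : Setoid a ℓ) where
  open Setoid S using (_≈_) renaming (sym to ≈-sym)

  Unique-lookup-injective : ∀ {xs} → Unique S xs → ∀ i j → lookup xs i ≈ lookup xs j → i ≡ j
  Unique-lookup-injective (_  ∷ _) fzero    fzero    _  = refl
  Unique-lookup-injective (x≉ ∷ _) fzero    (fsuc j) x≈ = contradiction x≈ (All.lookup x≉ (∈-lookup j))
  Unique-lookup-injective (x≉ ∷ _) (fsuc i) fzero    x≈ =
    contradiction (≈-sym x≈) (All.lookup x≉ (∈-lookup i))
  Unique-lookup-injective (_  ∷ u) (fsuc i) (fsuc j) x≈ = cong fsuc (Unique-lookup-injective u i j x≈)

∈-pairwise : ∀ {a r} {A : Set a} {R : A → A → Set r} {xs : List A}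
           → (∀ i j → i ≢ j → R (lookup xs i) (lookup xs j))
           → ∀ {x y} → x ∈ xs → y ∈ xs → x ≡ y ⊎ R x y
∈-pairwise {R = R} {xs} pairwise x∈ y∈ with index x∈ ≟ᶠ index y∈
... | yes i≡j = inj₁ (trans (lookup-index x∈) (trans (cong (lookup xs) i≡j) (sym (lookup-index y∈))))
... | no  i≢j = inj₂ (subst₂ R (sym (lookup-index x∈)) (sym (lookup-index y∈)) (pairwise _ _ i≢j))

module _ {n : ℕ} where

  sameBot : DecSetoid 0ℓ 0ℓ
  sameBot = On.decSetoid (decSetoid _≟_) (bot {n})

  private
    _≟bot_ : (a b : Arc n) → Dec (bot a ≡ bot b)
    _≟bot_ = DecSetoid._≟_ sameBot

  dedupByBot : List (Arc n) → List (Arc n)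
  dedupByBot = deduplicate _≟bot_

  dedupByBot-⊆ : ∀ A {a} → a ∈ dedupByBot A → a ∈ A
  dedupByBot-⊆ = ∈-deduplicate⁻ _≟bot_

  dedupByBot-bots-distinct : ∀ A i j → i ≢ j
                           → bot (lookup (dedupByBot A) i) ≢ bot (lookup (dedupByBot A) j)
  dedupByBot-bots-distinct A i j i≢j =
    i≢j ∘ Unique-lookup-injective (DecSetoid.setoid sameBot) (deduplicate-! sameBot A) i j

  dedupByBot-covers : ∀ A {a} → a ∈ A → Σ (Arc n) λ b → b ∈ dedupByBot A × bot a ≡ bot b
  dedupByBot-covers A a∈ =
    find (deduplicate⁺ _≟bot_ (λ b≡c a≡c → trans a≡c (sym b≡c)) (Any.map (cong bot) a∈))

module _ {n : ℕ} (A : List (Arc n))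
         (compatible : ∀ i j → i ≢ j → Compatible (lookup A i) (lookup A j)) where

  private
    ≡⊎compatible : ∀ {a b} → a ∈ A → b ∈ A → a ≡ b ⊎ Compatible a b
    ≡⊎compatible = ∈-pairwise {R = Compatible} compatible

  dedupByBot-compatible : ∀ i j → i ≢ j → Compatible (lookup (dedupByBot A) i) (lookup (dedupByBot A) j)
  dedupByBot-compatible i j i≢j
    with ≡⊎compatible (dedupByBot-⊆ A (∈-lookup i)) (dedupByBot-⊆ A (∈-lookup j))
  ... | inj₁ arc≡ = contradiction (cong bot arc≡) (dedupByBot-bots-distinct A i j i≢j)
  ... | inj₂ c    = c

  dedupByBot-represents : ∀ {a} → a ∈ A → Any (a ≈ᵃ_) (dedupByBot A)
  dedupByBot-represents {a} a∈ with dedupByBot-covers A a∈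
  ... | b , b∈ , bot≡ with ≡⊎compatible a∈ (dedupByBot-⊆ A b∈)
  ...   | inj₁ refl = lose b∈ (≈ᵃ-refl a)
  ...   | inj₂ c    = lose b∈ (compatible-bot-≡⇒≈ᵃ {x = a} {b} c bot≡)

proposition3p2 : (n : ℕ) (A : List (Arc n))
    → (∀ (i j : Fin (length A)) → i ≢ j → Compatible (lookup A i) (lookup A j))
    → Σ (NoncrossingArcDiagram n) λ D
        → All (λ a → a ∈ᴰ D) A × All (λ d → Any (d ≈ᵃ_) A) (arcs D)
proposition3p2 n A compatibleA =
  canonicalDiagram (dedupByBot A) (dedupByBot-compatible A compatibleA) (dedupByBot-bots-distinct A) ,
  All.tabulate (dedupByBot-represents A compatibleA) ,
  All.tabulate (λ {d} d∈ → Any.map (λ { refl → ≈ᵃ-refl d }) (dedupByBot-⊆ A d∈))
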